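{- Let $H$ be a graph with independence number $\alpha_H$ and let $\gamma_H:=|H|-\alpha_H-1$. Then both $B_{\gamma_H+1,\alpha_H}$ and the complete bipartite graph $K_{\gamma_H+1,\ \alpha_H+\binom{\gamma_H+1}{2}}$ contain subdivisions of $H$ (as subgraphs).
   Context: A subdivision of $H$ is a graph obtained by replacing some edges of $H$ by internally vertex-disjoint paths. $B_{s,t}:=K_s\vee(tK_1)$ is obtained by joining every vertex of an $s$-clique to every vertex of an independent set of $t$ vertices. -}

module Defs where

open import Data.Nat using (ℕ; _+_; _≤_; _<_; _∸_)
open import Data.Nat.Combinatorics using (_C_)
open import Data.Fin using (Fin; toℕ) renaming (_<_ to _<ᶠ_)
open import Data.List using (List; _∷_; []; _++_)
open import Data.List.Membership.Propositional using (_∈_)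
open import Data.List.Relation.Unary.Linked using (Linked)
open import Data.List.Relation.Unary.Unique.Propositional using (Unique)
open import Data.Product using (Σ; _×_; ∃)
open import Data.Sum using (_⊎_)
open import Function.Definitions using (Injective)
open import Relation.Binary.PropositionalEquality using (_≡_; _≢_)
open import Relation.Nullary using (¬_)
open import Level using (0ℓ)

record Graph : Set₁ where
  field
    n     : ℕ
    Adj   : Fin n → Fin n → Set
    sym   : ∀ {x y} → Adj x y → Adj y x
    irrefl : ∀ {x} → ¬ Adj x x
open Graph public

∣_∣ᵥ : Graph → ℕ
∣ H ∣ᵥ = n H

IndependentSet : (H : Graph) (k : ℕ) → Set
IndependentSet H k =
  Σ (Fin k → Fin (n H)) λ f →
    Injective _≡_ _≡_ f × (∀ i j → ¬ Adj H (f i) (f j))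

IsIndependenceNumber : Graph → ℕ → Set
IsIndependenceNumber H α =
  IndependentSet H α × (∀ k → IndependentSet H k → k ≤ α)

-- B_{s,t} = K_s ∨ (t K₁): vertices with index < s form the clique,
-- the remaining t vertices form the independent set, all joined to the clique.
B : ℕ → ℕ → Graph
B s t = record
  { n = s + t
  ; Adj = λ i j → i ≢ j × (toℕ i < s ⊎ toℕ j < s)
  ; sym = λ { (ne , inj₁ p) → (λ e → ne (Eq.sym e)) , inj₂ p
            ; (ne , inj₂ p) → (λ e → ne (Eq.sym e)) , inj₁ p }
  ; irrefl = λ { (ne , _) → ne Eq.refl }
  }
  where
  open Data.Product using (_,_)
  open Data.Sum using (inj₁; inj₂)
  import Relation.Binary.PropositionalEquality as Eq

K : ℕ → ℕ → Graph
K a b = record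
  { n = a + b
  ; Adj = λ i j → (toℕ i < a × a ≤ toℕ j) ⊎ (a ≤ toℕ i × toℕ j < a)
  ; sym = λ { (inj₁ (p , q)) → inj₂ (q , p) ; (inj₂ (p , q)) → inj₁ (q , p) }
  ; irrefl = λ { (inj₁ (p , q)) → <⇒≱ p q ; (inj₂ (p , q)) → <⇒≱ q p }
  }
  where
  open Data.Product using (_,_)
  open Data.Sum using (inj₁; inj₂)
  open import Data.Nat.Properties using (<⇒≱)

-- G contains (as a subgraph) a subdivision of H:
-- an injective placement φ of the branch vertices, and for every edge uv of H
-- (u < v) a list P u v of internal vertices such that
--   φ u, P u v, φ v is a path in G (consecutive vertices adjacent),
--   the internal vertices are distinct and not branch vertices,
--   and the paths of distinct edges are internally vertex-disjoint.
ContainsSubdivision : (G H : Graph) → Set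
ContainsSubdivision G H =
  Σ (Fin (n H) → Fin (n G)) λ φ →
  Σ (Fin (n H) → Fin (n H) → List (Fin (n G))) λ P →
    Injective _≡_ _≡_ φ ×
    (∀ u v → u <ᶠ v → Adj H u v →
        Linked (Adj G) (φ u ∷ (P u v ++ (φ v ∷ [])))
      × Unique (P u v)
      × (∀ x w → x ∈ P u v → x ≢ φ w)) ×
    (∀ u v u′ v′ → u <ᶠ v → Adj H u v → u′ <ᶠ v′ → Adj H u′ v′ →
        ∀ x → x ∈ P u v → x ∈ P u′ v′ → (u ≡ u′ × v ≡ v′))

-- Number the vertices of H so that an independent set I of size α comes last. In
-- B_{γ+1,α} the first γ+1 positions form a clique joined to everything, so every edge of
-- H, having at most one end in I, is already an edge of B. In K_{γ+1, α + C(γ+1,2)} only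
-- edges with exactly one end in I survive; each edge between two of the first γ+1
-- vertices is subdivided once, through its own extra vertex of the large side, indexed by
-- the triangular code of the pair of positions.
module Submission where

open import Defs hiding (sym)
open import Data.Nat using (ℕ; zero; suc; _+_; _∸_; _≤_; _<_; _⊓_; _⊔_; z≤n; s≤s; _<?_; _≟_)
open import Data.Nat.Properties
open import Data.Nat.Combinatorics using (_C_; nCk+nC[k+1]≡[n+1]C[k+1]; nC1≡n)
open import Data.Fin using (Fin; toℕ; fromℕ<; punchIn; punchOut) renaming (zero to fzero; suc to fsuc; _<_ to _<ᶠ_)
import Data.Fin.Properties as Finₚ
open import Data.List using (List; _∷_; []; _++_)
open import Data.List.Membership.Propositional using (_∈_)
open import Data.List.Relation.Unary.Any using (here)
open import Data.List.Relation.Unary.All using ([])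
open import Data.List.Relation.Unary.AllPairs using ([]; _∷_)
open import Data.List.Relation.Unary.Linked using (Linked; [-]; _∷_)
open import Data.List.Relation.Unary.Unique.Propositional using (Unique)
open import Data.Product using (_×_; ∃; _,_)
open import Data.Sum using (_⊎_; inj₁; inj₂)
import Data.Sum as Sum
import Data.Product as Product
open import Data.Empty using (⊥-elim)
open import Function using (_∘_)
open import Function.Definitions using (Injective)
open import Relation.Binary.PropositionalEquality
open import Relation.Binary.Definitions using (tri<; tri≈; tri>)
open import Relation.Nullary using (¬_; yes; no; contradiction)

[1+n]C2≡n+nC2 : ∀ n → suc n C 2 ≡ n + n C 2
[1+n]C2≡n+nC2 n = trans (sym (nCk+nC[k+1]≡[n+1]C[k+1] n 1)) (cong (_+ n C 2) (nC1≡n n))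

C2-mono-≤ : ∀ {m n} → m ≤ n → m C 2 ≤ n C 2
C2-mono-≤ z≤n = z≤n
C2-mono-≤ {suc m} {suc n} (s≤s m≤n) = begin
  suc m C 2 ≡⟨ [1+n]C2≡n+nC2 m ⟩
  m + m C 2 ≤⟨ +-mono-≤ m≤n (C2-mono-≤ m≤n) ⟩
  n + n C 2 ≡⟨ [1+n]C2≡n+nC2 n ⟨
  suc n C 2 ∎
  where open ≤-Reasoning

m+nC2<oC2 : ∀ {m n o} → m < n → n < o → m + n C 2 < o C 2
m+nC2<oC2 {m} {n} {o} m<n n<o = begin-strict
  m + n C 2 <⟨ +-monoˡ-< (n C 2) m<n ⟩
  n + n C 2 ≡⟨ [1+n]C2≡n+nC2 n ⟨
  suc n C 2 ≤⟨ C2-mono-≤ n<o ⟩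
  o C 2     ∎
  where open ≤-Reasoning

m+nC2-injective : ∀ {m n m′ n′} → m < n → m′ < n′ →
                  m + n C 2 ≡ m′ + n′ C 2 → m ≡ m′ × n ≡ n′
m+nC2-injective {m} {n} {m′} {n′} m<n m′<n′ eq with <-cmp n n′
... | tri< n<n′ _ _ = contradiction eq (<⇒≢ (≤-trans (m+nC2<oC2 m<n n<n′) (m≤n+m _ m′)))
... | tri≈ _ refl _ = +-cancelʳ-≡ (n C 2) m m′ eq , refl
... | tri> _ _ n′<n = contradiction (sym eq) (<⇒≢ (≤-trans (m+nC2<oC2 m′<n′ n′<n) (m≤n+m _ m)))

pairCode : ℕ → ℕ → ℕ
pairCode a b = a ⊓ b + (a ⊔ b) C 2

m≢n⇒m⊓n<m⊔n : ∀ {m n} → m ≢ n → m ⊓ n < m ⊔ n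
m≢n⇒m⊓n<m⊔n {m} {n} m≢n with <-cmp m n
... | tri< m<n _ _ rewrite m≤n⇒m⊓n≡m (<⇒≤ m<n) | m≤n⇒m⊔n≡n (<⇒≤ m<n) = m<n
... | tri≈ _ m≡n _ = contradiction m≡n m≢n
... | tri> _ _ n<m rewrite m≥n⇒m⊓n≡n (<⇒≤ n<m) | m≥n⇒m⊔n≡m (<⇒≤ n<m) = n<m

pairCode<sC2 : ∀ {a b s} → a ≢ b → a < s → b < s → pairCode a b < s C 2
pairCode<sC2 a≢b a<s b<s = m+nC2<oC2 (m≢n⇒m⊓n<m⊔n a≢b) (⊔-lub a<s b<s)

⊓-⊔-determine-pair : ∀ {a b c d} → a ⊓ b ≡ c ⊓ d → a ⊔ b ≡ c ⊔ d →
                     (a ≡ c × b ≡ d) ⊎ (a ≡ d × b ≡ c)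
⊓-⊔-determine-pair {a} {b} {c} {d} eq⊓ eq⊔ with ≤-total a b | ≤-total c d
... | inj₁ a≤b | inj₁ c≤d
  rewrite m≤n⇒m⊓n≡m a≤b | m≤n⇒m⊔n≡n a≤b | m≤n⇒m⊓n≡m c≤d | m≤n⇒m⊔n≡n c≤d = inj₁ (eq⊓ , eq⊔)
... | inj₁ a≤b | inj₂ d≤c
  rewrite m≤n⇒m⊓n≡m a≤b | m≤n⇒m⊔n≡n a≤b | m≥n⇒m⊓n≡n d≤c | m≥n⇒m⊔n≡m d≤c = inj₂ (eq⊓ , eq⊔)
... | inj₂ b≤a | inj₁ c≤d
  rewrite m≥n⇒m⊓n≡n b≤a | m≥n⇒m⊔n≡m b≤a | m≤n⇒m⊓n≡m c≤d | m≤n⇒m⊔n≡n c≤d = inj₂ (eq⊔ , eq⊓)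
... | inj₂ b≤a | inj₂ d≤c
  rewrite m≥n⇒m⊓n≡n b≤a | m≥n⇒m⊔n≡m b≤a | m≥n⇒m⊓n≡n d≤c | m≥n⇒m⊔n≡m d≤c = inj₁ (eq⊔ , eq⊓)

pairCode-injective : ∀ {a b c d} → a ≢ b → c ≢ d → pairCode a b ≡ pairCode c d →
                     (a ≡ c × b ≡ d) ⊎ (a ≡ d × b ≡ c)
pairCode-injective a≢b c≢d eq =
  let eq⊓ , eq⊔ = m+nC2-injective (m≢n⇒m⊓n<m⊔n a≢b) (m≢n⇒m⊓n<m⊔n c≢d) eq
  in ⊓-⊔-determine-pair eq⊓ eq⊔

Image : ∀ {k n} → (Fin k → Fin n) → Fin n → Set
Image f u = ∃ λ i → f i ≡ u

Image-∘ : ∀ {j k n} {f : Fin k → Fin n} {g : Fin j → Fin k} {u} → Image (f ∘ g) u → Image f u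
Image-∘ {g = g} (i , eq) = g i , eq

module Lower {k m} (f : Fin k → Fin (suc m)) (f≢0 : ∀ i → f i ≢ fzero) where

  lower : Fin k → Fin m
  lower i = punchOut (f≢0 i ∘ sym)

  suc∘lower : ∀ i → fsuc (lower i) ≡ f i
  suc∘lower i = Finₚ.punchIn-punchOut (f≢0 i ∘ sym)

  lower-injective : Injective _≡_ _≡_ f → Injective _≡_ _≡_ lower
  lower-injective f-inj {i} {j} eq =
    f-inj (trans (sym (suc∘lower i)) (trans (cong fsuc eq) (suc∘lower j)))

  lower-Image : ∀ {u} → Image lower u → Image f (fsuc u)
  lower-Image (i , eq) = i , trans (sym (suc∘lower i)) (cong fsuc eq)

record Numbering (n s t : ℕ) (Tail : Fin n → Set) : Set where
  field
    rank           : Fin n → ℕ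
    rank-injective : Injective _≡_ _≡_ rank
    rank<          : ∀ u → rank u < s + t
    tail           : ∀ u → s ≤ rank u → Tail u

module _ {n s t : ℕ} where

  Numbering-map : {P Q : Fin n → Set} → (∀ {u} → P u → Q u) →
                  Numbering n s t P → Numbering n s t Q
  Numbering-map P⇒Q N = record
    { rank = rank ; rank-injective = rank-injective ; rank< = rank<
    ; tail = λ u s≤r → P⇒Q (tail u s≤r) }
    where open Numbering N

  consHead : {T : Fin (suc n) → Set} → Numbering n s t (T ∘ fsuc) → Numbering (suc n) (suc s) t T
  consHead {T} N = record
    { rank = rank′ ; rank-injective = rank′-injective ; rank< = rank′< ; tail = tail′ }
    where
    open Numbering N
    rank′ : Fin (suc n) → ℕ
    rank′ fzero    = 0
    rank′ (fsuc u) = suc (rank u)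
    rank′-injective : Injective _≡_ _≡_ rank′
    rank′-injective {fzero}  {fzero}  _  = refl
    rank′-injective {fsuc u} {fsuc v} eq = cong fsuc (rank-injective (suc-injective eq))
    rank′< : ∀ u → rank′ u < suc s + t
    rank′< fzero    = s≤s z≤n
    rank′< (fsuc u) = s≤s (rank< u)
    tail′ : ∀ u → suc s ≤ rank′ u → T u
    tail′ (fsuc u) (s≤s s≤r) = tail u s≤r

  consTail : {T : Fin (suc n) → Set} → T fzero → Numbering n s t (T ∘ fsuc) →
             Numbering (suc n) s (suc t) T
  consTail {T} T0 N = record
    { rank = rank′ ; rank-injective = rank′-injective ; rank< = rank′< ; tail = tail′ }
    where
    open Numbering N
    s+t<s+1+t : s + t < s + suc t
    s+t<s+1+t = +-monoʳ-< s (n<1+n t)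
    rank′ : Fin (suc n) → ℕ
    rank′ fzero    = s + t
    rank′ (fsuc u) = rank u
    rank′-injective : Injective _≡_ _≡_ rank′
    rank′-injective {fzero}  {fzero}  _  = refl
    rank′-injective {fzero}  {fsuc v} eq = contradiction (sym eq) (<⇒≢ (rank< v))
    rank′-injective {fsuc u} {fzero}  eq = contradiction eq (<⇒≢ (rank< u))
    rank′-injective {fsuc u} {fsuc v} eq = cong fsuc (rank-injective eq)
    rank′< : ∀ u → rank′ u < s + suc t
    rank′< fzero    = s+t<s+1+t
    rank′< (fsuc u) = <-trans (rank< u) s+t<s+1+t
    tail′ : ∀ u → s ≤ rank′ u → T u
    tail′ fzero    _   = T0
    tail′ (fsuc u) s≤r = tail u s≤r

-- Induction on n: the vertex 0 goes to the end of the tail if it lies in the image of f,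
-- and to the front of the head otherwise.
numbering : ∀ {k n} (f : Fin k → Fin n) → Injective _≡_ _≡_ f → Numbering n (n ∸ k) k (Image f)
numbering {k} {zero} f _ = record { rank = λ () ; rank-injective = λ { {()} } ; rank< = λ () ; tail = λ () }
numbering {k} {suc m} f f-inj with Finₚ.any? (λ i → f i Finₚ.≟ fzero)
numbering {zero}  {suc m} f f-inj | yes (() , _)
numbering {suc k} {suc m} f f-inj | yes (i , fi≡0) =
  consTail (i , fi≡0) (Numbering-map (Image-∘ ∘ lower-Image) (numbering lower (lower-injective g-inj)))
  where
  g : Fin k → Fin (suc m)
  g = f ∘ punchIn i
  g-inj : Injective _≡_ _≡_ g
  g-inj {a} {b} eq = Finₚ.punchIn-injective i a b (f-inj eq)
  g≢0 : ∀ j → g j ≢ fzero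
  g≢0 j gj≡0 = Finₚ.punchInᵢ≢i i j (f-inj (trans gj≡0 (sym fi≡0)))
  open Lower g g≢0
numbering {k} {suc m} f f-inj | no 0∉f =
  subst (λ s → Numbering (suc m) s k (Image f)) (sym (+-∸-assoc 1 k≤m))
    (consHead (Numbering-map lower-Image (numbering lower lower-inj)))
  where
  open Lower f (λ i fi≡0 → 0∉f (i , fi≡0))
  lower-inj : Injective _≡_ _≡_ lower
  lower-inj = lower-injective f-inj
  k≤m : k ≤ m
  k≤m = Finₚ.injective⇒≤ lower-inj

ordered-pair : ∀ {n} {u v u′ v′ : Fin n} → u <ᶠ v → u′ <ᶠ v′ →
               (u ≡ u′ × v ≡ v′) ⊎ (u ≡ v′ × v ≡ u′) → u ≡ u′ × v ≡ v′
ordered-pair _   _    (inj₁ same)        = same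
ordered-pair u<v u′<v′ (inj₂ (refl , refl)) = ⊥-elim (Finₚ.<-asym u<v u′<v′)

module PairSubdivision (s t : ℕ) where

  s+t≤s+[t+sC2] : s + t ≤ s + (t + s C 2)
  s+t≤s+[t+sC2] = +-monoʳ-≤ s (m≤m+n t (s C 2))

  pairVertex : ∀ {a b} → a ≢ b → a < s → b < s → Fin (s + (t + s C 2))
  pairVertex a≢b a<s b<s = fromℕ< (+-monoʳ-< s (+-monoʳ-< t (pairCode<sC2 a≢b a<s b<s)))

  s≤pairVertex : ∀ {a b} (a≢b : a ≢ b) (a<s : a < s) (b<s : b < s) → s ≤ toℕ (pairVertex a≢b a<s b<s)
  s≤pairVertex a≢b a<s b<s = subst (s ≤_) (sym (Finₚ.toℕ-fromℕ< _)) (m≤m+n s _)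

  subdivider : ℕ → ℕ → List (Fin (s + (t + s C 2)))
  subdivider a b with a <? s | b <? s | a ≟ b
  ... | yes a<s | yes b<s | no a≢b = pairVertex a≢b a<s b<s ∷ []
  ... | _       | _       | _      = []

  subdivider-linked : ∀ (i j : Fin (s + (t + s C 2))) → toℕ i ≢ toℕ j → ¬ (s ≤ toℕ i × s ≤ toℕ j) →
                      Linked (Adj (K s (t + s C 2))) (i ∷ (subdivider (toℕ i) (toℕ j) ++ j ∷ []))
  subdivider-linked i j i≢j not-both with toℕ i <? s | toℕ j <? s | toℕ i ≟ toℕ j
  ... | yes i<s | yes j<s | no i≢j′ =
    inj₁ (i<s , s≤pairVertex i≢j′ i<s j<s) ∷ inj₂ (s≤pairVertex i≢j′ i<s j<s , j<s) ∷ [-]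
  ... | yes _   | yes _   | yes i≡j = contradiction i≡j i≢j
  ... | yes i<s | no j≮s  | _       = inj₁ (i<s , ≮⇒≥ j≮s) ∷ [-]
  ... | no i≮s  | yes j<s | _       = inj₂ (≮⇒≥ i≮s , j<s) ∷ [-]
  ... | no i≮s  | no j≮s  | _       = ⊥-elim (not-both (≮⇒≥ i≮s , ≮⇒≥ j≮s))

  subdivider-unique : ∀ a b → Unique (subdivider a b)
  subdivider-unique a b with a <? s | b <? s | a ≟ b
  ... | yes _ | yes _ | no _  = [] ∷ []
  ... | yes _ | yes _ | yes _ = []
  ... | yes _ | no _  | _     = []
  ... | no _  | _     | _     = []

  ∈-subdivider : ∀ {a b x} → x ∈ subdivider a b → a ≢ b × toℕ x ≡ s + (t + pairCode a b)
  ∈-subdivider {a} {b} x∈ with a <? s | b <? s | a ≟ b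
  ∈-subdivider (here refl) | yes _ | yes _ | no a≢b = a≢b , Finₚ.toℕ-fromℕ< _

module WithIndependentTail
  (H : Graph) {s t : ℕ} {Tail : Fin (n H) → Set} (N : Numbering (n H) s t Tail)
  (tail-independent : ∀ {u v} → Tail u → Tail v → ¬ Adj H u v) where

  open Numbering N

  rank-≢ : ∀ {u v} → Adj H u v → rank u ≢ rank v
  rank-≢ uv eq with rank-injective eq
  ... | refl = irrefl H uv

  not-both-tail : ∀ {u v} → Adj H u v → ¬ (s ≤ rank u × s ≤ rank v)
  not-both-tail uv (s≤u , s≤v) = tail-independent (tail _ s≤u) (tail _ s≤v) uv

  embed : ∀ {m} → s + t ≤ m → Fin (n H) → Fin m
  embed s+t≤m u = fromℕ< (≤-trans (rank< u) s+t≤m)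

  toℕ-embed : ∀ {m} (s+t≤m : s + t ≤ m) u → toℕ (embed s+t≤m u) ≡ rank u
  toℕ-embed _ _ = Finₚ.toℕ-fromℕ< _

  embed-injective : ∀ {m} (s+t≤m : s + t ≤ m) → Injective _≡_ _≡_ (embed s+t≤m)
  embed-injective s+t≤m {u} {v} eq =
    rank-injective (trans (sym (toℕ-embed s+t≤m u)) (trans (cong toℕ eq) (toℕ-embed s+t≤m v)))

  embed-≢ : ∀ {m} (s+t≤m : s + t ≤ m) {u v} → Adj H u v → embed s+t≤m u ≢ embed s+t≤m v
  embed-≢ s+t≤m uv = rank-≢ uv ∘ cong rank ∘ embed-injective s+t≤m

  head-end : ∀ {u v} → Adj H u v → rank u < s ⊎ rank v < s
  head-end {u} {v} uv with rank u <? s | rank v <? s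
  ... | yes u<s | _       = inj₁ u<s
  ... | no _    | yes v<s = inj₂ v<s
  ... | no u≮s  | no v≮s  = ⊥-elim (not-both-tail uv (≮⇒≥ u≮s , ≮⇒≥ v≮s))

  B-subdivision : ContainsSubdivision (B s t) H
  B-subdivision = embed ≤-refl , (λ _ _ → []) , embed-injective ≤-refl ,
    (λ u v _ uv → (edge uv ∷ [-]) , [] , λ _ _ ()) ,
    λ _ _ _ _ _ _ _ _ _ ()
    where
    edge : ∀ {u v} → Adj H u v → Adj (B s t) (embed ≤-refl u) (embed ≤-refl v)
    edge {u} {v} uv = embed-≢ ≤-refl uv ,
      Sum.map (subst (_< s) (sym (toℕ-embed ≤-refl u))) (subst (_< s) (sym (toℕ-embed ≤-refl v)))
              (head-end uv)

  open PairSubdivision s t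

  K-subdivision : ContainsSubdivision (K s (t + s C 2)) H
  K-subdivision = φ , P , embed-injective s+t≤s+[t+sC2] ,
    (λ u v _ uv → linked uv , subdivider-unique _ _ , internal≢branch) ,
    disjoint
    where
    φ : Fin (n H) → Fin (s + (t + s C 2))
    φ = embed s+t≤s+[t+sC2]
    toℕ-φ : ∀ u → toℕ (φ u) ≡ rank u
    toℕ-φ = toℕ-embed s+t≤s+[t+sC2]
    toℕ∘φ-injective : Injective _≡_ _≡_ (toℕ ∘ φ)
    toℕ∘φ-injective = embed-injective s+t≤s+[t+sC2] ∘ Finₚ.toℕ-injective
    P : Fin (n H) → Fin (n H) → List (Fin (s + (t + s C 2)))
    P u v = subdivider (toℕ (φ u)) (toℕ (φ v))
    linked : ∀ {u v} → Adj H u v → Linked (Adj (K s (t + s C 2))) (φ u ∷ (P u v ++ φ v ∷ []))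
    linked {u} {v} uv = subdivider-linked (φ u) (φ v)
      (embed-≢ s+t≤s+[t+sC2] uv ∘ Finₚ.toℕ-injective)
      (not-both-tail uv ∘ Product.map (subst (s ≤_) (toℕ-φ u)) (subst (s ≤_) (toℕ-φ v)))
    internal≢branch : ∀ {u v} x w → x ∈ P u v → x ≢ φ w
    internal≢branch {u} {v} x w x∈ x≡φw = <⇒≢ φw<x (cong toℕ (sym x≡φw))
      where
      open ≤-Reasoning
      φw<x : toℕ (φ w) < toℕ x
      φw<x = begin-strict
        toℕ (φ w)                                  ≡⟨ toℕ-φ w ⟩
        rank w                                     <⟨ rank< w ⟩
        s + t                                      ≤⟨ +-monoʳ-≤ s (m≤m+n t _) ⟩
        s + (t + pairCode (toℕ (φ u)) (toℕ (φ v))) ≡⟨ Product.proj₂ (∈-subdivider x∈) ⟨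
        toℕ x                                      ∎
    disjoint : ∀ u v u′ v′ → u <ᶠ v → Adj H u v → u′ <ᶠ v′ → Adj H u′ v′ →
               ∀ x → x ∈ P u v → x ∈ P u′ v′ → u ≡ u′ × v ≡ v′
    disjoint u v u′ v′ u<v _ u′<v′ _ x x∈ x∈′ =
      let uv≢ , x≡ = ∈-subdivider x∈
          uv≢′ , x≡′ = ∈-subdivider x∈′
          same-code = +-cancelˡ-≡ t _ _ (+-cancelˡ-≡ s _ _ (trans (sym x≡) x≡′))
      in ordered-pair u<v u′<v′
           (Sum.map (Product.map toℕ∘φ-injective toℕ∘φ-injective)
                     (Product.map toℕ∘φ-injective toℕ∘φ-injective)
             (pairCode-injective uv≢ uv≢′ same-code))

lemma2p2 : (H : Graph) (α : ℕ) → IsIndependenceNumber H α →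
    ContainsSubdivision (B (∣ H ∣ᵥ ∸ α) α) H
    × ContainsSubdivision (K (∣ H ∣ᵥ ∸ α) (α + ((∣ H ∣ᵥ ∸ α) C 2))) H
lemma2p2 H α ((f , f-inj , f-independent) , _) = B-subdivision , K-subdivision
  where
  independent-image : ∀ {u v} → Image f u → Image f v → ¬ Adj H u v
  independent-image (i , refl) (j , refl) = f-independent i j
  open WithIndependentTail H (numbering f f-inj) independent-image
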